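{- Let $k\geq 4$ and let $G$ be a $(P_1+P_5)$-free graph with a $P_k$-suitable pair $(u,v)$ such that $N(u)$ is an independent set. Then $G$ has a $P_k$-witness structure $\mathcal W$ with $W(p_1)=\{u\}$ and $W(p_k)=\{v\}$ such that $W(p_2)\setminus N(u)$ contains a set $S$ with $|S|\leq 2$ for which $N(u)\cup S$ induces a connected subgraph of $G$.
   Context: $P_k=p_1\cdots p_k$ is the path on $k$ vertices, $+$ denotes disjoint union; a graph is $H$-free if it has no induced subgraph isomorphic to $H$; $N(u)$ is the set of neighbours of $u$. A $P_k$-witness structure of $G$ is a partition of $V(G)$ into nonempty sets $W(p_1),\dots,W(p_k)$, each inducing a connected subgraph, with $W(p_i),W(p_j)$ joined by an edge iff $|i-j|=1$. Non-adjacent vertices $u,v$ form a $P_k$-suitable pair if there is such a structure with $W(p_1)=\{u\}$, $W(p_k)=\{v\}$. -}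

module Defs where

open import Data.Nat using (ℕ; zero; suc; _∸_; _≤_)
open import Data.Fin using (Fin; toℕ)
open import Data.Bool using (Bool; true; false; T; _∨_)
open import Data.Bool.Properties using (∨-comm)
open import Data.List using (List; length)
open import Data.List.Membership.Propositional using (_∈_)
open import Data.Product using (Σ; ∃; _×_; _,_)
open import Data.Sum using (_⊎_)
open import Relation.Nullary using (¬_)
open import Relation.Binary.PropositionalEquality using (_≡_)
open import Function.Bundles using (_⇔_)

record Graph (n : ℕ) : Set where
  field
    adj    : Fin n → Fin n → Bool
    sym    : ∀ x y → adj x y ≡ adj y x
    irrefl : ∀ x → adj x x ≡ false

open Graph public

module _ {n : ℕ} (G : Graph n) where

  Adj : Fin n → Fin n → Set
  Adj x y = T (adj G x y)

  data WalkIn (P : Fin n → Set) : Fin n → Fin n → Set where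
    here : ∀ {x} → P x → WalkIn P x x
    step : ∀ {x z y} → P x → Adj x z → WalkIn P z y → WalkIn P x y

  Connected : (Fin n → Set) → Set
  Connected P = ∀ x y → P x → P y → WalkIn P x y

  N : Fin n → Fin n → Set
  N u x = Adj u x

  IndependentNbhd : Fin n → Set
  IndependentNbhd u = ∀ x y → N u x → N u y → ¬ Adj x y

  InducedCopy : {m : ℕ} → Graph m → Set
  InducedCopy {m} H =
    Σ (Fin m → Fin n) λ f →
      (∀ i j → f i ≡ f j → i ≡ j) × (∀ i j → adj G (f i) (f j) ≡ adj H i j)

  Free : {m : ℕ} → Graph m → Set
  Free H = ¬ InducedCopy H

  Consecutive : {k : ℕ} → Fin k → Fin k → Set
  Consecutive i j = (toℕ j ≡ suc (toℕ i)) ⊎ (toℕ i ≡ suc (toℕ j))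

  -- A P_k-witness structure: w x = i means x ∈ W(p_{i+1}).
  record WitnessStructure (k : ℕ) (w : Fin n → Fin k) : Set where
    field
      nonempty  : ∀ i → ∃ λ x → w x ≡ i
      connected : ∀ i → Connected (λ x → w x ≡ i)
      edges     : ∀ i j → ¬ i ≡ j →
                  (∃ λ x → ∃ λ y → w x ≡ i × w y ≡ j × Adj x y) ⇔ Consecutive i j

  Ends : (k : ℕ) → (Fin n → Fin k) → Fin n → Fin n → Set
  Ends k w u v = (∀ x → (toℕ (w x) ≡ 0) ⇔ (x ≡ u))
               × (∀ x → (toℕ (w x) ≡ k ∸ 1) ⇔ (x ≡ v))

  SuitablePair : ℕ → Fin n → Fin n → Set
  SuitablePair k u v =
    ¬ Adj u v × (∃ λ (w : Fin n → Fin k) → WitnessStructure k w × Ends k w u v)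

-- The graph P_1 + P_5 on Fin 6: vertex 0 isolated, path 1-2-3-4-5.
-- forward edges i -> i+1 for i = 1..4
P1+P5fwd : Fin 6 → Fin 6 → Bool
P1+P5fwd i j with toℕ i | toℕ j
... | 1 | 2 = true
... | 2 | 3 = true
... | 3 | 4 = true
... | 4 | 5 = true
... | _ | _ = false

P1+P5adj : Fin 6 → Fin 6 → Bool
P1+P5adj i j = P1+P5fwd i j ∨ P1+P5fwd j i

P1+P5 : Graph 6
P1+P5 = record { adj = P1+P5adj ; sym = λ x y → ∨-comm (P1+P5fwd x y) (P1+P5fwd y x) ; irrefl = r }
  where
  open import Data.Fin using (zero; suc)
  open import Relation.Binary.PropositionalEquality using (refl)
  r : ∀ x → P1+P5adj x x ≡ false
  r zero = refl
  r (suc zero) = refl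
  r (suc (suc zero)) = refl
  r (suc (suc (suc zero))) = refl
  r (suc (suc (suc (suc zero)))) = refl
  r (suc (suc (suc (suc (suc zero))))) = refl

module Submission where

-- Let W(p₂) = B and D = N(u).  Since W(p₁) = {u}, D ⊆ B, and
-- since k ≥ 4 the vertex v is adjacent neither to u nor to anything in B;
-- so v can serve as the isolated vertex of an induced P₁ + P₅ whose path
-- lies in {u} ∪ B.  We look for S inside R = B \ D.  If |D| ≤ 1 then S = ∅
-- works.  If some edge rx of R dominates D (every vertex of D is adjacent to
-- r or x), S = {r, x} works.  Otherwise two adjacent vertices of R have
-- nested neighbourhoods in D (else an undominated b ∈ D gives the induced P₅
-- b-u-a-r-x), and a vertex m ∈ R with the most neighbours in D dominates D on
-- its own: walking from m to any d ∈ D inside the connected set B, every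
-- vertex met is either in D and adjacent to m, or in R with no D-neighbour
-- outside N(m) (a violation yields an induced P₅ or a vertex of R beating m).
-- Then S = {m}.

open import Defs
open import Data.Nat using (ℕ; zero; suc; _≤_; s≤s; z≤n)
open import Data.Nat.Properties using (≤-trans; ≤-reflexive; n≤1+n; <⇒≱; 0≢1+n) renaming (_≟_ to _≟ⁿ_)
open import Data.Fin using (Fin; toℕ; zero; suc; _<_)
open import Data.Fin.Properties using (any?; all?; ¬∀⟶∃¬; toℕ-injective; <-cmp)
  renaming (_≟_ to _≟ᶠ_)
open import Data.Fin.Subset using (Subset; ∣_∣; _⊂_) renaming (_∈_ to _∈ₛ_)
open import Data.Fin.Subset.Properties using (p⊂q⇒∣p∣<∣q∣)
open import Data.Bool using (true; false; T)
open import Data.Bool.Properties using (T?; T-≡; ¬-not) renaming (_≟_ to _≟ᵇ_)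
open import Data.Vec using (tabulate; lookup; []; _∷_)
open import Data.Vec.Properties using (lookup∘tabulate; lookup⇒[]=; []=⇒lookup)
open import Data.List using (List; length; filter; allFin) renaming ([] to []ˡ; _∷_ to _∷ˡ_)
open import Data.List.Membership.Propositional using (_∈_)
open import Data.List.Membership.Propositional.Properties using (∈-filter⁺; ∈-allFin)
open import Data.List.Relation.Unary.Any using (here; there)
import Data.List.Relation.Unary.All as All
open import Data.List.Relation.Unary.All.Properties using (all-filter)
open import Data.List.Extrema.Nat using (argmax; argmax-all; f[xs]≤f[argmax])
open import Data.Product using (Σ; ∃; _×_; _,_; proj₁; proj₂)
open import Data.Sum using (_⊎_; inj₁; inj₂)
open import Data.Empty using (⊥-elim)
open import Function using (_∘_)
open import Function.Bundles using (Equivalence; _⇔_)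
open import Relation.Nullary using (¬_; Dec; yes; no; ¬?; _×-dec_; _⊎-dec_; _→-dec_)
open import Relation.Nullary.Decidable using (from-yes; decidable-stable; dec-true)
open import Relation.Nullary.Reflects using (Reflects; invert)
open import Relation.Unary using (Decidable)
open import Relation.Binary.PropositionalEquality using (_≡_; refl; trans; cong; subst) renaming (sym to ≡-sym)
open import Relation.Binary.Definitions using (tri<; tri≈; tri>)
open Equivalence using (to; from)

counterexample : ∀ {n} {P Q : Fin n → Set} → Decidable P → Decidable Q →
  ¬ (∀ x → P x → Q x) → ∃ λ x → P x × ¬ Q x
counterexample {n} P? Q? ¬all with ¬∀⟶∃¬ n _ (λ x → P? x →-dec Q? x) ¬all
... | x , ¬imp with P? x
...   | yes p = x , p , λ q → ¬imp (λ _ → q)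
...   | no ¬p = ⊥-elim (¬imp (⊥-elim ∘ ¬p))

maximiser : ∀ {n} {P : Fin n → Set} → Decidable P → (c : Fin n → ℕ) → Σ (Fin n) P →
  Σ (Fin n) λ m → P m × (∀ y → P y → c y ≤ c m)
maximiser {n} P? c (x₀ , p₀) =
  m , argmax-all c p₀ (all-filter P? (allFin n)) ,
  λ y py → All.lookup (f[xs]≤f[argmax] x₀ candidates) (∈-filter⁺ P? (∈-allFin y) py)
  where
  candidates : List (Fin n)
  candidates = filter P? (allFin n)
  m : Fin n
  m = argmax c x₀ candidates

⟦_⟧ : ∀ {n} {P : Fin n → Set} → Decidable P → Subset n
⟦ P? ⟧ = tabulate (λ x → Dec.does (P? x))

∈⟦⟧⁺ : ∀ {n} {P : Fin n → Set} (P? : Decidable P) {x} → P x → x ∈ₛ ⟦ P? ⟧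
∈⟦⟧⁺ P? {x} px = lookup⇒[]= x _ (trans (lookup∘tabulate _ x) (dec-true (P? x) px))

∈⟦⟧⁻ : ∀ {n} {P : Fin n → Set} (P? : Decidable P) {x} → x ∈ₛ ⟦ P? ⟧ → P x
∈⟦⟧⁻ {P = P} P? {x} x∈ = invert (subst (Reflects (P x)) does≡true (Dec.proof (P? x)))
  where
  does≡true : Dec.does (P? x) ≡ true
  does≡true = trans (≡-sym (lookup∘tabulate _ x)) ([]=⇒lookup x∈)

module GraphFacts {n : ℕ} (G : Graph n) where

  adj-sym : ∀ {x y} → Adj G x y → Adj G y x
  adj-sym {x} {y} = subst T (Graph.sym G x y)

  Adj? : ∀ x y → Dec (Adj G x y)
  Adj? x y = T? (adj G x y)

  true-of : ∀ {x y} → Adj G x y → adj G x y ≡ true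
  true-of = to T-≡

  false-of : ∀ {x y} → ¬ Adj G x y → adj G x y ≡ false
  false-of ¬xy = ¬-not (¬xy ∘ from T-≡)

  walk-start : ∀ {P : Fin n → Set} {x y} → WalkIn G P x y → P x
  walk-start (here p) = p
  walk-start (step p _ _) = p

  walk-map : ∀ {P Q : Fin n → Set} → (∀ {x} → P x → Q x) → ∀ {x y} → WalkIn G P x y → WalkIn G Q x y
  walk-map f (here p) = here (f p)
  walk-map f (step p xz walk) = step (f p) xz (walk-map f walk)

  walk-++ : ∀ {P : Fin n → Set} {x y z} → WalkIn G P x y → WalkIn G P y z → WalkIn G P x z
  walk-++ (here _) walk = walk
  walk-++ (step p xz walk₁) walk₂ = step p xz (walk-++ walk₁ walk₂)

  walk-reverse : ∀ {P : Fin n → Set} {x y} → WalkIn G P x y → WalkIn G P y x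
  walk-reverse (here p) = here p
  walk-reverse (step p xz walk) = walk-++ (walk-reverse walk) (step (walk-start walk) (adj-sym xz) (here p))

  subsingleton-connected : ∀ {P : Fin n → Set} → (∀ {x y} → P x → P y → x ≡ y) → Connected G P
  subsingleton-connected same x y px py = subst (WalkIn G _ x) (same px py) (here px)

  reach-dominator : ∀ {D S : Fin n → Set} → (∀ d → D d → ∃ λ s → S s × Adj G d s) →
    ∀ {x} → D x ⊎ S x → ∃ λ s → S s × WalkIn G (λ y → D y ⊎ S y) x s
  reach-dominator dominated (inj₂ Sx) = _ , Sx , here (inj₂ Sx)
  reach-dominator dominated (inj₁ Dx) with dominated _ Dx
  ... | s , Ss , xs = s , Ss , step (inj₁ Dx) xs (here (inj₂ Ss))

  dominated-extension : ∀ {D S : Fin n → Set} → Connected G S →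
    (∀ d → D d → ∃ λ s → S s × Adj G d s) → Connected G (λ x → D x ⊎ S x)
  dominated-extension S-connected dominated x y px py
    with reach-dominator dominated px | reach-dominator dominated py
  ... | s , Ss , x⇝s | t , St , y⇝t =
    walk-++ x⇝s (walk-++ (walk-map inj₂ (S-connected s t Ss St)) (walk-reverse y⇝t))

  edge-connected : ∀ {r x} → Adj G r x → Connected G (_∈ r ∷ˡ x ∷ˡ []ˡ)
  edge-connected rx _ _ (here refl) (here refl) = here (here refl)
  edge-connected rx _ _ (here refl) (there (here refl)) = step (here refl) rx (here (there (here refl)))
  edge-connected rx _ _ (there (here refl)) (here refl) = step (there (here refl)) (adj-sym rx) (here (here refl))
  edge-connected rx _ _ (there (here refl)) (there (here refl)) = here (there (here refl))

module InducedCopies {n : ℕ} (G : Graph n) where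

  from-upper : ∀ {m} (H : Graph m) (f : Fin m → Fin n) →
    (∀ i j → i < j → adj G (f i) (f j) ≡ adj H i j) → ∀ i j → adj G (f i) (f j) ≡ adj H i j
  from-upper H f upper i j with <-cmp i j
  ... | tri< i<j _ _ = upper i j i<j
  ... | tri≈ _ refl _ = trans (irrefl G (f i)) (≡-sym (irrefl H i))
  ... | tri> _ _ j<i = trans (Graph.sym G (f i) (f j)) (trans (upper j i j<i) (Graph.sym H j i))

  distinguishing-injective : ∀ {m} (H : Graph m) → (∀ i j → (∀ l → adj H i l ≡ adj H j l) → i ≡ j) →
    (f : Fin m → Fin n) → (∀ i j → adj G (f i) (f j) ≡ adj H i j) → ∀ i j → f i ≡ f j → i ≡ j
  distinguishing-injective H distinct f preserve i j fi≡fj = distinct i j λ l →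
    trans (≡-sym (preserve i l)) (trans (cong (λ x → adj G x (f l)) fi≡fj) (preserve j l))

P1+P5-distinguishing : ∀ i j → (∀ l → P1+P5adj i l ≡ P1+P5adj j l) → i ≡ j
P1+P5-distinguishing = from-yes
  (all? λ i → all? λ j → all? (λ l → P1+P5adj i l ≟ᵇ P1+P5adj j l) →-dec (i ≟ᶠ j))

module P1+P5-Recognition {n : ℕ} (G : Graph n) where
  open GraphFacts G
  open InducedCopies G

  record InducedP1+P5 (z p₁ p₂ p₃ p₄ p₅ : Fin n) : Set where
    field
      p₁~p₂ : Adj G p₁ p₂
      p₂~p₃ : Adj G p₂ p₃
      p₃~p₄ : Adj G p₃ p₄
      p₄~p₅ : Adj G p₄ p₅
      p₁≁p₃ : ¬ Adj G p₁ p₃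
      p₁≁p₄ : ¬ Adj G p₁ p₄
      p₁≁p₅ : ¬ Adj G p₁ p₅
      p₂≁p₄ : ¬ Adj G p₂ p₄
      p₂≁p₅ : ¬ Adj G p₂ p₅
      p₃≁p₅ : ¬ Adj G p₃ p₅
      z≁p₁ : ¬ Adj G z p₁
      z≁p₂ : ¬ Adj G z p₂
      z≁p₃ : ¬ Adj G z p₃
      z≁p₄ : ¬ Adj G z p₄
      z≁p₅ : ¬ Adj G z p₅

  induced-copy : ∀ {z p₁ p₂ p₃ p₄ p₅} → InducedP1+P5 z p₁ p₂ p₃ p₄ p₅ → InducedCopy G P1+P5
  induced-copy {z} {p₁} {p₂} {p₃} {p₄} {p₅} copy =
    f , distinguishing-injective P1+P5 P1+P5-distinguishing f preserve , preserve
    where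
    open InducedP1+P5 copy
    f : Fin 6 → Fin n
    f = lookup (z ∷ p₁ ∷ p₂ ∷ p₃ ∷ p₄ ∷ p₅ ∷ [])
    upper : ∀ i j → i < j → adj G (f i) (f j) ≡ P1+P5adj i j
    upper zero (suc zero) _ = false-of z≁p₁
    upper zero (suc (suc zero)) _ = false-of z≁p₂
    upper zero (suc (suc (suc zero))) _ = false-of z≁p₃
    upper zero (suc (suc (suc (suc zero)))) _ = false-of z≁p₄
    upper zero (suc (suc (suc (suc (suc zero))))) _ = false-of z≁p₅
    upper (suc zero) (suc (suc zero)) _ = true-of p₁~p₂
    upper (suc zero) (suc (suc (suc zero))) _ = false-of p₁≁p₃
    upper (suc zero) (suc (suc (suc (suc zero)))) _ = false-of p₁≁p₄
    upper (suc zero) (suc (suc (suc (suc (suc zero))))) _ = false-of p₁≁p₅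
    upper (suc (suc zero)) (suc (suc (suc zero))) _ = true-of p₂~p₃
    upper (suc (suc zero)) (suc (suc (suc (suc zero)))) _ = false-of p₂≁p₄
    upper (suc (suc zero)) (suc (suc (suc (suc (suc zero))))) _ = false-of p₂≁p₅
    upper (suc (suc (suc zero))) (suc (suc (suc (suc zero)))) _ = true-of p₃~p₄
    upper (suc (suc (suc zero))) (suc (suc (suc (suc (suc zero))))) _ = false-of p₃≁p₅
    upper (suc (suc (suc (suc zero)))) (suc (suc (suc (suc (suc zero))))) _ = true-of p₄~p₅
    upper _ zero ()
    upper (suc _) (suc zero) (s≤s ())
    upper (suc (suc _)) (suc (suc zero)) (s≤s (s≤s ()))
    upper (suc (suc (suc _))) (suc (suc (suc zero))) (s≤s (s≤s (s≤s ())))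
    upper (suc (suc (suc (suc _)))) (suc (suc (suc (suc zero)))) (s≤s (s≤s (s≤s (s≤s ()))))
    upper (suc (suc (suc (suc (suc _))))) (suc (suc (suc (suc (suc zero))))) (s≤s (s≤s (s≤s (s≤s (s≤s ())))))
    preserve : ∀ i j → adj G (f i) (f j) ≡ P1+P5adj i j
    preserve = from-upper P1+P5 f upper

module KeyLemma {n : ℕ} (G : Graph n) (free : Free G P1+P5) (u z : Fin n)
  (B : Fin n → Set) (B? : Decidable B) (B-connected : Connected G B)
  (N⊆B : ∀ {x} → N G u x → B x) (independent : IndependentNbhd G u)
  (z≁u : ¬ Adj G z u) (z≁B : ∀ {x} → B x → ¬ Adj G z x) where

  open GraphFacts G
  open P1+P5-Recognition G

  D : Fin n → Set
  D = N G u

  D? : Decidable D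
  D? = Adj? u

  R : Fin n → Set
  R x = B x × ¬ D x

  R? : Decidable R
  R? x = B? x ×-dec ¬? (D? x)

  Certificate : Set
  Certificate = ∃ λ (S : List (Fin n)) → length S ≤ 2 ×
    (∀ x → x ∈ S → R x) × Connected G (λ x → D x ⊎ x ∈ S)

  dominating-certificate : (S : List (Fin n)) → length S ≤ 2 → (∀ x → x ∈ S → R x) →
    Connected G (_∈ S) → (∀ d → D d → ∃ λ s → s ∈ S × Adj G d s) → Certificate
  dominating-certificate S |S|≤2 S⊆R S-connected dominated =
    S , |S|≤2 , S⊆R , dominated-extension S-connected dominated

  subsingleton-certificate : (∀ {d d′} → D d → D d′ → d ≡ d′) → Certificate
  subsingleton-certificate same = []ˡ , z≤n , (λ _ ()) , subsingleton-connected same′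
    where
    same′ : ∀ {x y} → D x ⊎ x ∈ []ˡ → D y ⊎ y ∈ []ˡ → x ≡ y
    same′ (inj₁ Dx) (inj₁ Dy) = same Dx Dy

  DominatingEdge : Fin n → Fin n → Set
  DominatingEdge r x = R r × R x × Adj G r x × (∀ d → D d → Adj G r d ⊎ Adj G x d)

  DominatingEdge? : ∀ r x → Dec (DominatingEdge r x)
  DominatingEdge? r x = R? r ×-dec R? x ×-dec Adj? r x ×-dec
    all? (λ d → D? d →-dec (Adj? r d ⊎-dec Adj? x d))

  edge-certificate : ∀ {r x} → DominatingEdge r x → Certificate
  edge-certificate {r} {x} (Rr , Rx , rx , dominates) =
    dominating-certificate (r ∷ˡ x ∷ˡ []ˡ) (s≤s (s≤s z≤n)) S⊆R (edge-connected rx) dominated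
    where
    S⊆R : ∀ y → y ∈ r ∷ˡ x ∷ˡ []ˡ → R y
    S⊆R _ (here refl) = Rr
    S⊆R _ (there (here refl)) = Rx
    dominated : ∀ d → D d → ∃ λ s → s ∈ r ∷ˡ x ∷ˡ []ˡ × Adj G d s
    dominated d Dd with dominates d Dd
    ... | inj₁ rd = r , here refl , adj-sym rd
    ... | inj₂ xd = x , there (here refl) , adj-sym xd

  vertex-certificate : Σ (Fin n) (λ m → R m × (∀ d → D d → Adj G m d)) → Certificate
  vertex-certificate (m , Rm , dominates) =
    dominating-certificate (m ∷ˡ []ˡ) (s≤s z≤n) (λ { _ (here refl) → Rm })
      (subsingleton-connected λ { (here refl) (here refl) → refl })
      (λ d Dd → m , here refl , adj-sym (dominates d Dd))

  -- Two distinct vertices of N(u) are joined inside B; the first step leaves N(u).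
  R-inhabited : ∀ {d₀ d₁} → D d₀ → D d₁ → ¬ d₀ ≡ d₁ → Σ (Fin n) R
  R-inhabited {d₀} {d₁} D₀ D₁ d₀≢d₁ with B-connected d₀ d₁ (N⊆B D₀) (N⊆B D₁)
  ... | here _ = ⊥-elim (d₀≢d₁ refl)
  ... | step {z = y} _ d₀y walk = y , walk-start walk , λ Dy → independent d₀ y D₀ Dy d₀y

  module NoDominatingEdge (none : ∀ r x → ¬ DominatingEdge r x) where

    -- Along an edge of R, neighbours in N(u) are inherited; otherwise an
    -- undominated b ∈ N(u) gives the induced P₅ b-u-a-r-x (with z isolated).
    inherit : ∀ {r x a} → R r → R x → Adj G r x → D a → Adj G r a → Adj G x a
    inherit {r} {x} {a} Rr Rx rx Da ra with Adj? x a
    ... | yes xa = xa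
    ... | no ¬xa with counterexample D? (λ d → Adj? r d ⊎-dec Adj? x d)
                        (λ dominates → none r x (Rr , Rx , rx , dominates))
    ...   | b , Db , ¬rb⊎xb = ⊥-elim (free (induced-copy record
      { p₁~p₂ = adj-sym Db ; p₂~p₃ = Da ; p₃~p₄ = adj-sym ra ; p₄~p₅ = rx
      ; p₁≁p₃ = independent b a Db Da
      ; p₁≁p₄ = ¬rb⊎xb ∘ inj₁ ∘ adj-sym ; p₁≁p₅ = ¬rb⊎xb ∘ inj₂ ∘ adj-sym
      ; p₂≁p₄ = proj₂ Rr ; p₂≁p₅ = proj₂ Rx ; p₃≁p₅ = ¬xa ∘ adj-sym
      ; z≁p₁ = z≁B (N⊆B Db) ; z≁p₂ = z≁u ; z≁p₃ = z≁B (N⊆B Da)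
      ; z≁p₄ = z≁B (proj₁ Rr) ; z≁p₅ = z≁B (proj₁ Rx) }))

    N-in-D : Fin n → Subset n
    N-in-D r = ⟦ (λ d → D? d ×-dec Adj? r d) ⟧

    N-in-D⁺ : ∀ {r d} → D d → Adj G r d → d ∈ₛ N-in-D r
    N-in-D⁺ {r} Dd rd = ∈⟦⟧⁺ (λ d → D? d ×-dec Adj? r d) (Dd , rd)

    N-in-D⁻ : ∀ {r d} → d ∈ₛ N-in-D r → D d × Adj G r d
    N-in-D⁻ {r} = ∈⟦⟧⁻ (λ d → D? d ×-dec Adj? r d)

    module Maximal (m : Fin n) (Rm : R m) (maximal : ∀ r → R r → ∣ N-in-D r ∣ ≤ ∣ N-in-D m ∣) where

      -- A vertex r ∈ R two steps from m via y ∈ N(m) ∩ N(u) has no neighbour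
      -- in N(u) outside N(m): otherwise N(m) ∩ N(u) ⊊ N(r) ∩ N(u).
      two-steps : ∀ {y r a} → D y → Adj G m y → R r → Adj G y r → D a → Adj G r a → Adj G m a
      two-steps {y} {r} {a} Dy my Rr yr Da ra with Adj? m a
      ... | yes ma = ma
      ... | no ¬ma = ⊥-elim (<⇒≱ (p⊂q⇒∣p∣<∣q∣ larger) (maximal r Rr))
        where
        -- a neighbour b of m in N(u) is one of r: else a-r-y-m-b is an induced P₅
        covered : ∀ {b} → D b → Adj G m b → Adj G r b
        covered {b} Db mb with Adj? r b | Adj? r m
        ... | yes rb | _ = rb
        ... | no _ | yes rm = ⊥-elim (¬ma (inherit Rr Rm rm Da ra))
        ... | no ¬rb | no ¬rm = ⊥-elim (free (induced-copy record
          { p₁~p₂ = adj-sym ra ; p₂~p₃ = adj-sym yr ; p₃~p₄ = adj-sym my ; p₄~p₅ = mb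
          ; p₁≁p₃ = independent a y Da Dy ; p₁≁p₄ = ¬ma ∘ adj-sym
          ; p₁≁p₅ = independent a b Da Db
          ; p₂≁p₄ = ¬rm ; p₂≁p₅ = ¬rb ; p₃≁p₅ = independent y b Dy Db
          ; z≁p₁ = z≁B (N⊆B Da) ; z≁p₂ = z≁B (proj₁ Rr) ; z≁p₃ = z≁B (N⊆B Dy)
          ; z≁p₄ = z≁B (proj₁ Rm) ; z≁p₅ = z≁B (N⊆B Db) }))
        larger : N-in-D m ⊂ N-in-D r
        larger = (λ b∈ → let (Db , mb) = N-in-D⁻ b∈ in N-in-D⁺ Db (covered Db mb))
               , a , N-in-D⁺ Da ra , ¬ma ∘ proj₂ ∘ N-in-D⁻

      -- the invariant maintained along walks in B starting at m
      Tame : Fin n → Set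
      Tame y = (D y × Adj G m y) ⊎ (R y × (∀ {a} → D a → Adj G y a → Adj G m a))

      -- Tame is preserved by steps inside B (D is independent; inherit and two-steps)
      tame-step : ∀ {y y′} → Tame y → Adj G y y′ → B y′ → Tame y′
      tame-step {y} {y′} (inj₁ (Dy , my)) yy′ By′ with D? y′
      ... | yes Dy′ = ⊥-elim (independent y y′ Dy Dy′ yy′)
      ... | no ¬Dy′ = inj₂ ((By′ , ¬Dy′) , two-steps Dy my (By′ , ¬Dy′) yy′)
      tame-step {y} {y′} (inj₂ (Ry , inherited)) yy′ By′ with D? y′
      ... | yes Dy′ = inj₁ (Dy′ , inherited Dy′ yy′)
      ... | no ¬Dy′ = inj₂ ((By′ , ¬Dy′) , λ Da y′a → inherited Da (inherit (By′ , ¬Dy′) Ry (adj-sym yy′) Da y′a))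

      tame-walk : ∀ {y d} → WalkIn G B y d → Tame y → D d → Adj G m d
      tame-walk (here _) (inj₁ (_ , md)) _ = md
      tame-walk (here _) (inj₂ (Rd , _)) Dd = ⊥-elim (proj₂ Rd Dd)
      tame-walk (step _ yy′ walk) tame Dd = tame-walk walk (tame-step tame yy′ (walk-start walk)) Dd

      -- m itself is tame, and B connects m to every vertex of N(u)
      dominates : ∀ d → D d → Adj G m d
      dominates d Dd = tame-walk (B-connected m d (proj₁ Rm) (N⊆B Dd)) (inj₂ (Rm , λ _ ma → ma)) Dd

    dominating-vertex : Σ (Fin n) R → Σ (Fin n) (λ m → R m × (∀ d → D d → Adj G m d))
    dominating-vertex r₀ with maximiser R? (∣_∣ ∘ N-in-D) r₀
    ... | m , Rm , maximal = m , Rm , Maximal.dominates m Rm maximal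

  key : Certificate
  key with any? (λ d₀ → any? λ d₁ → D? d₀ ×-dec D? d₁ ×-dec ¬? (d₀ ≟ᶠ d₁))
  ... | no ¬two = subsingleton-certificate λ {d} {d′} Dd Dd′ →
          decidable-stable (d ≟ᶠ d′) (λ d≢d′ → ¬two (d , d′ , Dd , Dd′ , d≢d′))
  ... | yes (d₀ , d₁ , D₀ , D₁ , d₀≢d₁) with any? (λ r → any? (DominatingEdge? r))
  ...   | yes (_ , _ , edge) = edge-certificate edge
  ...   | no ¬edge = vertex-certificate (NoDominatingEdge.dominating-vertex
          (λ r x edge → ¬edge (r , x , edge)) (R-inhabited D₀ D₁ d₀≢d₁))

module WitnessFacts {n : ℕ} (G : Graph n) {k : ℕ} {w : Fin n → Fin k} (ws : WitnessStructure G k w) where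
  open GraphFacts G
  open WitnessStructure ws

  edge-bags : ∀ {x y} → Adj G x y → w x ≡ w y ⊎ Consecutive G (w x) (w y)
  edge-bags {x} {y} xy with w x ≟ᶠ w y
  ... | yes same = inj₁ same
  ... | no different = inj₂ (to (edges (w x) (w y) different) (x , y , refl , refl , xy))

  distant-bags : ∀ {x y} → suc (suc (toℕ (w x))) ≤ toℕ (w y) → ¬ Adj G x y
  distant-bags {x} {y} gap xy = <⇒≱ gap (close (edge-bags xy))
    where
    close : w x ≡ w y ⊎ Consecutive G (w x) (w y) → toℕ (w y) ≤ suc (toℕ (w x))
    close (inj₁ same) = subst (λ i → toℕ i ≤ suc (toℕ (w x))) same (n≤1+n _)
    close (inj₂ (inj₁ next)) = ≤-reflexive next
    close (inj₂ (inj₂ prev)) = ≤-trans (n≤1+n _) (≤-trans (≤-reflexive (≡-sym prev)) (n≤1+n _))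

  bag-connected : ∀ i → Connected G (λ x → toℕ (w x) ≡ toℕ i)
  bag-connected i x y px py =
    walk-map (cong toℕ) (connected i x y (toℕ-injective px) (toℕ-injective py))

  neighbours-of-first : ∀ {u} → (∀ x → (toℕ (w x) ≡ 0) ⇔ (x ≡ u)) → ∀ {x} → Adj G u x → toℕ (w x) ≡ 1
  neighbours-of-first {u} first {x} ux with edge-bags ux
  ... | inj₁ same = ⊥-elim (subst T (irrefl G u) (subst (Adj G u) (to (first x) x-first) ux))
    where
    x-first : toℕ (w x) ≡ 0
    x-first = trans (cong toℕ (≡-sym same)) (from (first u) refl)
  ... | inj₂ (inj₁ next) = trans next (cong suc (from (first u) refl))
  ... | inj₂ (inj₂ prev) = ⊥-elim (0≢1+n (trans (≡-sym (from (first u) refl)) prev))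

lemma16 : ∀ {n : ℕ} (G : Graph n) (k : ℕ) (u v : Fin n) →
    4 ≤ k → Free G P1+P5 → SuitablePair G k u v → IndependentNbhd G u →
    ∃ λ (w : Fin n → Fin k) → WitnessStructure G k w × Ends G k w u v ×
      (∃ λ (S : List (Fin n)) → length S ≤ 2 ×
        (∀ x → x ∈ S → (toℕ (w x) ≡ 1) × ¬ N G u x) ×
        Connected G (λ x → N G u x ⊎ x ∈ S))
lemma16 {n} G (suc (suc (suc (suc k)))) u v (s≤s (s≤s (s≤s (s≤s _)))) free
  (u≁v , w , ws , first , last) independent =
  w , ws , (first , last) ,
  KeyLemma.key G free u v W₂ W₂? (bag-connected (suc zero)) (neighbours-of-first first)
    independent (u≁v ∘ adj-sym) v≁W₂
  where
  open GraphFacts G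
  open WitnessFacts G ws

  W₂ : Fin n → Set
  W₂ x = toℕ (w x) ≡ 1

  W₂? : Decidable W₂
  W₂? x = toℕ (w x) ≟ⁿ 1

  -- v lies in W(p_k) with k ≥ 4, so it has no neighbour in W(p₂)
  v≁W₂ : ∀ {x} → W₂ x → ¬ Adj G v x
  v≁W₂ {x} x∈W₂ = distant-bags gap ∘ adj-sym
    where
    gap : suc (suc (toℕ (w x))) ≤ toℕ (w v)
    gap rewrite x∈W₂ | from (last v) refl = s≤s (s≤s (s≤s z≤n))
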